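{- Let $(G,c,k)$ be an instance of \textsc{Multi-STC}, let $A\subseteq\mathscr{P}$ be a periphery component and let $L$ be an STC-labeling of $G$. Let $P=(v_0,v_1,\dots,v_{r-1},v_0)$ be a cycle in $G[A]$ with $W_L\cap E(P)\ne\emptyset$, and let $Q_L^P=(q_0,q_1,\dots,q_{r-1})$ be its color sequence under $L$. Then there exist STC-labelings $L_0,\dots,L_{r-1}$ of $G$, each partially equal to $L$ on $E\setminus E(P)$, such that for every $i\in\{0,\dots,r-1\}$ either $|W_{L_i}|<|W_L|$ or $Q_{L_i}^P(j)=q_{(i+j)\bmod r}$ for all $j\in\{0,\dots,r-1\}$.
   Context: A $c$-colored labeling of $G=(V,E)$ is a partition $L=(S^1_L,\dots,S^c_L,W_L)$ of $E$; it is an STC-labeling if there are no $\{u,v\},\{v,w\}\in S^i_L$ ($u\ne w$) with $\{u,w\}\notin E$. Fix $D\subseteq E$ such that $(V,E\setminus D)$ has maximum degree at most $\lfloor c/2\rfloor+1$; the core $\mathscr{C}$ is the set of vertices incident with an edge of $D$, $\mathscr{P}=V\setminus\mathscr{C}$, and a periphery component is the vertex set of a connected component of $G[\mathscr{P}]$. A cycle is an edge-simple path $(v_0,\dots,v_{r-1},v_0)$ whose first and last vertex coincide and whose other vertices occur at most once; $E(P)$ is its edge set. The color sequence of a path $P$ under $L$ lists, for its consecutive edges in order (the $j$th entry $Q_L^P(j)$ for edge $\{P(j),P(j+1)\}$, indices from $0$), the index $i$ of the strong class $S^i_L$ containing it, or $0$ if weak. Labelings $L,L'$ are partially equal on $E'$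 if for all $e\in E'$ and all $i$, $e\in S^i_L\iff e\in S^i_{L'}$. -}

module Defs where

import Data.Nat
open import Data.Nat using (ℕ; zero; suc; _+_; _≤_; _<_; ⌊_/2⌋; NonZero)
open import Data.Nat.DivMod using (_mod_)
open import Data.Fin using (Fin; toℕ)
open import Data.Bool using (Bool; true; false; if_then_else_; _∧_; not)
open import Data.List using (List; map)
open import Data.Nat.ListAction using (sum)
open import Data.List using () renaming (allFin to allFinL)
open import Data.Product using (Σ; ∃; _×_; _,_)
open import Data.Sum using (_⊎_)
open import Relation.Nullary using (¬_; Dec; yes; no)
open import Relation.Nullary.Decidable using (⌊_⌋)
open import Relation.Binary.PropositionalEquality using (_≡_; _≢_)
import Data.Fin as F

record Graph (n : ℕ) : Set where
  field
    adj     : Fin n → Fin n → Bool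
    adj-sym : ∀ u v → adj u v ≡ adj v u
    irrefl  : ∀ v → adj v v ≡ false
open Graph public

Edge : ∀ {n} → Graph n → Fin n → Fin n → Set
Edge G u v = adj G u v ≡ true

countB : ∀ {n} → (Fin n → Bool) → ℕ
countB {n} p = sum (map (λ x → if p x then 1 else 0) (allFinL n))

-- A c-colored labeling: every edge gets a class in Fin (suc c);
-- 0 means W_L (weak), i = suc j means the strong class S^{i}_L.
-- Values on non-edges are irrelevant.
record Labeling (n c : ℕ) : Set where
  field
    col     : Fin n → Fin n → Fin (suc c)
    col-sym : ∀ u v → col u v ≡ col v u
open Labeling public

IsSTC : ∀ {n c} → Graph n → Labeling n c → Set
IsSTC G L = ∀ u v w → u ≢ w → Edge G u v → Edge G v w →
  col L u v ≢ F.zero → col L u v ≡ col L v w → Edge G u w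

isZero : ∀ {c} → Fin (suc c) → Bool
isZero F.zero    = true
isZero (F.suc _) = false

weakCount : ∀ {n c} → Graph n → Labeling n c → ℕ
weakCount {n} G L =
  sum (map (λ u → countB (λ v → ⌊ toℕ u Data.Nat.<? toℕ v ⌋ ∧ adj G u v ∧ isZero (col L u v)))
           (allFinL n))

record DeletionSet {n : ℕ} (G : Graph n) (c : ℕ) : Set where
  field
    inD     : Fin n → Fin n → Bool
    D-sym   : ∀ u v → inD u v ≡ inD v u
    D⊆E     : ∀ u v → inD u v ≡ true → Edge G u v
    degBound : ∀ v → countB (λ w → adj G v w ∧ not (inD v w)) ≤ ⌊ c /2⌋ + 1
open DeletionSet public

InCore : ∀ {n c} {G : Graph n} → DeletionSet G c → Fin n → Set
InCore D v = ∃ λ w → inD D v w ≡ true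

InPeriphery : ∀ {n c} {G : Graph n} → DeletionSet G c → Fin n → Set
InPeriphery D v = ¬ InCore D v

data Reach {n} (G : Graph n) (A : Fin n → Set) : Fin n → Fin n → Set where
  here : ∀ {a} → Reach G A a a
  step : ∀ {a b d} → Reach G A a b → A d → Edge G b d → Reach G A a d

IsPeripheryComponent : ∀ {n c} {G : Graph n} → DeletionSet G c → (Fin n → Set) → Set
IsPeripheryComponent {G = G} D A =
    (∃ λ a → A a)
  × (∀ a → A a → InPeriphery D a)
  × (∀ a b → A a → A b → Reach G A a b)
  × (∀ a b → A a → InPeriphery D b → Edge G a b → A b)

nxt : ∀ {r} .{{_ : NonZero r}} → Fin r → Fin r
nxt {r} j = (suc (toℕ j)) mod r

SamePair : ∀ {n} → Fin n → Fin n → Fin n → Fin n → Set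
SamePair a b a' b' = (a ≡ a' × b ≡ b') ⊎ (a ≡ b' × b ≡ a')

IsCycleIn : ∀ {n} (G : Graph n) (A : Fin n → Set) (r : ℕ) .{{_ : NonZero r}} → (Fin r → Fin n) → Set
IsCycleIn G A r P =
    (∀ j → A (P j))
  × (∀ j → Edge G (P j) (P (nxt j)))
  × (∀ i j → P i ≡ P j → i ≡ j)
  × (∀ i j → SamePair (P i) (P (nxt i)) (P j) (P (nxt j)) → i ≡ j)

InCycleEdges : ∀ {n r} .{{_ : NonZero r}} → (Fin r → Fin n) → Fin n → Fin n → Set
InCycleEdges P u v = ∃ λ j → SamePair u v (P j) (P (nxt j))

colorSeq : ∀ {n c r} .{{_ : NonZero r}} → Labeling n c → (Fin r → Fin n) → Fin r → Fin (suc c)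
colorSeq L P j = col L (P j) (P (nxt j))

PartiallyEqualOn : ∀ {n c} → Graph n → (Fin n → Fin n → Set) → Labeling n c → Labeling n c → Set
PartiallyEqualOn G E' L L' = ∀ u v → Edge G u v → E' u v → col L u v ≡ col L' u v

-- Periphery vertices have degree at most ⌊c/2⌋ + 1, so around an edge {a,b} of such a cycle
-- at most 2⌊c/2⌋ ≤ c occurrences of strong colours are seen.  Hence if {a,b} is weak and
-- {b,x} is the next cycle edge, either some colour is free at both ends, so {a,b} can be made
-- strong and |W_L| drops, or every colour occurs exactly once around {a,b}, and the label of
-- {b,x} can be moved onto {a,b}, {b,x} becoming weak, without violating STC
-- (strengthen-or-shift, shift-step).  Repeating this step along the cycle, starting at a weak
-- edge and going once around, moves every label back by one edge (shift-along, rotate-once);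
-- k such rotations give the labeling L_k of the lemma (rotate).
module Submission where

open import Defs
open import Data.Nat
  using (ℕ; zero; suc; pred; _+_; _∸_; _≤_; _<_; _%_; ⌊_/2⌋; ⌈_/2⌉; z≤n; s≤s; NonZero; _<?_)
open import Data.Nat.Properties
open import Data.Nat.DivMod using (_mod_; %-distribˡ-+; m%n%n≡m%n; [m+n]%n≡m%n; m<n⇒m%n≡m; m%n<n)
open import Data.Fin using (Fin; toℕ; zero; suc; punchIn; punchOut)
open import Data.Fin.Properties
  using (any?; punchInᵢ≢i; punchIn-punchOut; toℕ-injective; toℕ-fromℕ<; toℕ<n) renaming (_≟_ to _≟ᶠ_)
open import Data.Bool using (Bool; true; false; if_then_else_; _∧_; not)
open import Data.Bool.Properties using (∧-zeroʳ; ∧-identityʳ)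
open import Data.List using (map; tabulate)
open import Data.Nat.ListAction using () renaming (sum to listSum)
open import Algebra.Properties.CommutativeMonoid.Sum +-0-commutativeMonoid
  using (sum; sum-cong-≗; sum-remove; ∑-comm; ∑-distrib-+; sum-replicate-zero)
open import Algebra.Properties.CommutativeSemigroup +-commutativeSemigroup using (xy∙z≈zy∙x)
open import Data.Product using (Σ; ∃; _×_; _,_; proj₁; proj₂)
open import Data.Sum using (_⊎_; inj₁; inj₂)
import Data.Sum
import Data.Product
open import Data.Empty using (⊥; ⊥-elim)
open import Relation.Nullary using (¬_; Dec; yes; no; does)
open import Relation.Nullary.Decidable using (⌊_⌋; dec-true; dec-false; does-⇔; _×-dec_; _⊎-dec_)
open import Function.Bundles using (mk⇔)
open import Relation.Binary.Definitions using (tri<; tri≈; tri>)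
open import Relation.Binary.PropositionalEquality

ind : Bool → ℕ
ind b = if b then 1 else 0

count : ∀ {n} → (Fin n → Bool) → ℕ
count p = sum (λ x → ind (p x))

listSum-tabulate : ∀ {A : Set} n (g : Fin n → A) (f : A → ℕ) →
  listSum (map f (tabulate g)) ≡ sum (λ x → f (g x))
listSum-tabulate zero    g f = refl
listSum-tabulate (suc n) g f = cong (f (g zero) +_) (listSum-tabulate n (λ x → g (suc x)) f)

countB≡count : ∀ {n} (p : Fin n → Bool) → countB p ≡ count p
countB≡count {n} p = listSum-tabulate n (λ x → x) (λ x → ind (p x))

count-cong : ∀ {n} {p q : Fin n → Bool} → (∀ x → p x ≡ q x) → count p ≡ count q
count-cong e = sum-cong-≗ (λ x → cong ind (e x))

∑-zero : ∀ {n} {f : Fin n → ℕ} → (∀ x → f x ≡ 0) → sum f ≡ 0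
∑-zero {n} e = trans (sum-cong-≗ e) (sum-replicate-zero n)

∑-mono : ∀ {n} {f g : Fin n → ℕ} → (∀ x → f x ≤ g x) → sum f ≤ sum g
∑-mono {zero}  le = z≤n
∑-mono {suc n} le = +-mono-≤ (le zero) (∑-mono (λ x → le (suc x)))

∑-≥ : ∀ {n} (f : Fin n → ℕ) i → f i ≤ sum f
∑-≥ {suc n} f i = ≤-trans (m≤m+n (f i) _) (≤-reflexive (sym (sum-remove {i = i} f)))

∑-agree-off : ∀ {n} (f g : Fin n → ℕ) i → (∀ x → x ≢ i → f x ≡ g x) →
  sum f + g i ≡ sum g + f i
∑-agree-off {suc n} f g i agree = begin
    sum f + g i                     ≡⟨ cong (_+ g i) (sum-remove {i = i} f) ⟩
    f i + sum (λ k → f (punchIn i k)) + g i ≡⟨ cong (λ t → f i + t + g i) rest ⟩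
    f i + sum (λ k → g (punchIn i k)) + g i ≡⟨ xy∙z≈zy∙x (f i) _ (g i) ⟩
    g i + sum (λ k → g (punchIn i k)) + f i ≡⟨ cong (_+ f i) (sum-remove {i = i} g) ⟨
    sum g + f i                     ∎
  where
  open ≡-Reasoning
  rest : sum (λ k → f (punchIn i k)) ≡ sum (λ k → g (punchIn i k))
  rest = sum-cong-≗ (λ k → agree (punchIn i k) (punchInᵢ≢i i k))

∑∑-agree-off : ∀ {n m} (f g : Fin n → Fin m → ℕ) i j →
  (∀ x y → ¬ (x ≡ i × y ≡ j) → f x y ≡ g x y) →
  sum (λ x → sum (f x)) + g i j ≡ sum (λ x → sum (g x)) + f i j
∑∑-agree-off {suc n} {suc m} f g i j agree = begin
    sum (λ x → sum (f x)) + g i j ≡⟨ cong (_+ g i j) (split f) ⟩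
    f i j + rest f + g i j        ≡⟨ cong (λ t → f i j + t + g i j) rest-equal ⟩
    f i j + rest g + g i j        ≡⟨ xy∙z≈zy∙x (f i j) (rest g) (g i j) ⟩
    g i j + rest g + f i j        ≡⟨ cong (_+ f i j) (split g) ⟨
    sum (λ x → sum (g x)) + f i j ∎
  where
  open ≡-Reasoning
  rest : (Fin (suc n) → Fin (suc m) → ℕ) → ℕ
  rest h = sum (λ k → h i (punchIn j k)) + sum (λ k → sum (h (punchIn i k)))
  split : ∀ h → sum (λ x → sum (h x)) ≡ h i j + rest h
  split h = begin
    sum (λ x → sum (h x))                                   ≡⟨ sum-remove {i = i} (λ x → sum (h x)) ⟩
    sum (h i) + rows                                        ≡⟨ cong (_+ rows) (sum-remove {i = j} (h i)) ⟩
    h i j + sum (λ k → h i (punchIn j k)) + rows            ≡⟨ +-assoc (h i j) _ _ ⟩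
    h i j + rest h                                          ∎
    where
    rows : ℕ
    rows = sum (λ k → sum (h (punchIn i k)))
  rest-equal : rest f ≡ rest g
  rest-equal = cong₂ _+_
    (sum-cong-≗ (λ k → agree i (punchIn j k) (λ (_ , e) → punchInᵢ≢i j k e)))
    (sum-cong-≗ (λ k → sum-cong-≗ (λ y → agree (punchIn i k) y (λ (e , _) → punchInᵢ≢i i k e))))

count-pos : ∀ {n} (p : Fin n → Bool) z → p z ≡ true → 1 ≤ count p
count-pos p z pz = subst (λ b → ind b ≤ count p) pz (∑-≥ (λ x → ind (p x)) z)

count-two : ∀ {n} (p : Fin n → Bool) z z' → p z ≡ true → p z' ≡ true → z ≢ z' → 2 ≤ count p
count-two {suc n} p z z' pz pz' z≢z' = begin
    2                                          ≡⟨⟩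
    1 + 1                                      ≤⟨ +-mono-≤ (≤-reflexive (cong ind (sym pz))) second ⟩
    ind (p z) + count (λ k → p (punchIn z k))  ≡⟨ sum-remove {i = z} (λ x → ind (p x)) ⟨
    count p                                    ∎
  where
  open ≤-Reasoning
  second : 1 ≤ count (λ k → p (punchIn z k))
  second = count-pos (λ k → p (punchIn z k)) (punchOut z≢z') (trans (cong p (punchIn-punchOut z≢z')) pz')

count-remove : ∀ {n} (p : Fin n → Bool) b → p b ≡ true →
  count (λ z → p z ∧ not (does (z ≟ᶠ b))) + 1 ≡ count p
count-remove {n} p b pb = begin
    count p' + 1         ≡⟨ cong (λ t → count p' + ind t) pb ⟨
    count p' + ind (p b) ≡⟨ ∑-agree-off (λ z → ind (p' z)) (λ z → ind (p z)) b off-b ⟩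
    count p + ind (p' b) ≡⟨ cong (λ t → count p + ind (p b ∧ not t)) (dec-true (b ≟ᶠ b) refl) ⟩
    count p + ind (p b ∧ false) ≡⟨ cong (λ t → count p + ind t) (∧-zeroʳ (p b)) ⟩
    count p + 0          ≡⟨ +-identityʳ _ ⟩
    count p              ∎
  where
  open ≡-Reasoning
  p' : Fin n → Bool
  p' z = p z ∧ not (does (z ≟ᶠ b))
  off-b : ∀ z → z ≢ b → ind (p' z) ≡ ind (p z)
  off-b z z≢b = trans (cong (λ t → ind (p z ∧ not t)) (dec-false (z ≟ᶠ b) z≢b))
                      (cong ind (∧-identityʳ (p z)))

∑-point : ∀ {c} (v : Fin c) → sum (λ y → ind (does (v ≟ᶠ y))) ≡ 1
∑-point {suc c} v = begin
    sum (λ y → ind (does (v ≟ᶠ y)))                                  ≡⟨ sum-remove {i = v} point ⟩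
    ind (does (v ≟ᶠ v)) + sum (λ k → ind (does (v ≟ᶠ punchIn v k)))  ≡⟨ cong₂ (λ s t → ind s + t)
                                                                            (dec-true (v ≟ᶠ v) refl) others ⟩
    1                                                                ∎
  where
  open ≡-Reasoning
  point : Fin (suc c) → ℕ
  point y = ind (does (v ≟ᶠ y))
  others : sum (λ k → ind (does (v ≟ᶠ punchIn v k))) ≡ 0
  others = ∑-zero (λ k → cong ind (dec-false (v ≟ᶠ punchIn v k) (λ e → punchInᵢ≢i v k (sym e))))

one-colour : ∀ {c} (v : Fin (suc c)) → sum (λ y → ind (does (v ≟ᶠ suc y))) ≤ 1
one-colour {c} zero = ≤-trans (≤-reflexive (∑-zero {c} (λ _ → refl))) z≤n
one-colour (suc v)  = ≤-reflexive (∑-point v)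

colourClass : ∀ {n c} → (Fin n → Bool) → (Fin n → Fin (suc c)) → Fin c → ℕ
colourClass p f y = count (λ z → p z ∧ does (f z ≟ᶠ suc y))

-- The colour classes are disjoint, so together they have at most count p elements.
∑-colourClass : ∀ {n c} (p : Fin n → Bool) (f : Fin n → Fin (suc c)) →
  sum (colourClass p f) ≤ count p
∑-colourClass {c = c} p f = begin
    sum (colourClass p f)                                    ≡⟨ ∑-comm (λ y z → ind (p z ∧ does (f z ≟ᶠ suc y))) ⟩
    sum (λ z → sum (λ y → ind (p z ∧ does (f z ≟ᶠ suc y))))  ≤⟨ ∑-mono per-element ⟩
    count p                                                  ∎
  where
  open ≤-Reasoning
  per-element : ∀ z → sum (λ y → ind (p z ∧ does (f z ≟ᶠ suc y))) ≤ ind (p z)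
  per-element z with p z
  ... | true  = one-colour (f z)
  ... | false = ≤-reflexive (∑-zero {c} (λ _ → refl))

∑-ones : ∀ m → sum {m} (λ _ → 1) ≡ m
∑-ones zero    = refl
∑-ones (suc m) = cong suc (∑-ones m)

at-most-one : ∀ {c} (f : Fin c → ℕ) → sum f ≤ c → (∀ y → 1 ≤ f y) → ∀ y → f y ≤ 1
at-most-one {suc c} f total positive y with f y ≤? 1
... | yes fy≤1 = fy≤1
... | no fy≰1 = ⊥-elim (<-irrefl refl (≤-trans too-many total))
  where
  open ≤-Reasoning
  others : c ≤ sum (λ k → f (punchIn y k))
  others = ≤-trans (≤-reflexive (sym (∑-ones c))) (∑-mono (λ k → positive (punchIn y k)))
  too-many : suc (suc c) ≤ sum f
  too-many = begin
    2 + c                                ≤⟨ +-mono-≤ (≰⇒> fy≰1) others ⟩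
    f y + sum (λ k → f (punchIn y k))    ≡⟨ sum-remove {i = y} f ⟨
    sum f                                ∎

Edge-sym : ∀ {n} (G : Graph n) {u v} → Edge G u v → Edge G v u
Edge-sym G {u} {v} e = trans (adj-sym G v u) e

Edge-irrefl : ∀ {n} (G : Graph n) {u v} → Edge G u v → u ≢ v
Edge-irrefl G {u} e refl with trans (sym e) (irrefl G u)
... | ()

samePair? : ∀ {n} (u z a b : Fin n) → Dec (SamePair u z a b)
samePair? u z a b = (u ≟ᶠ a ×-dec z ≟ᶠ b) ⊎-dec (u ≟ᶠ b ×-dec z ≟ᶠ a)

samePair-flip : ∀ {n} {u z a b : Fin n} → SamePair u z a b → SamePair z u a b
samePair-flip (inj₁ (p , q)) = inj₂ (q , p)
samePair-flip (inj₂ (p , q)) = inj₁ (q , p)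

not-pair : ∀ {n} {a z b x : Fin n} → a ≢ b → a ≢ x → ¬ SamePair a z b x
not-pair a≢b a≢x (inj₁ (e , _)) = a≢b e
not-pair a≢b a≢x (inj₂ (e , _)) = a≢x e

relabel : ∀ {n c} → Labeling n c → Fin n → Fin n → Fin (suc c) → Labeling n c
col (relabel L a b v) u z = if does (samePair? u z a b) then v else col L u z
col-sym (relabel L a b v) u z = cong₂ (λ d l → if d then v else l)
  (does-⇔ (mk⇔ samePair-flip samePair-flip) (samePair? u z a b) (samePair? z u a b))
  (col-sym L u z)

relabel-on : ∀ {n c} (L : Labeling n c) {a b u z} v → SamePair u z a b → col (relabel L a b v) u z ≡ v
relabel-on L {a} {b} {u} {z} v s rewrite dec-true (samePair? u z a b) s = refl

relabel-off : ∀ {n c} (L : Labeling n c) {a b u z} v → ¬ SamePair u z a b →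
  col (relabel L a b v) u z ≡ col L u z
relabel-off L {a} {b} {u} {z} v ns rewrite dec-false (samePair? u z a b) ns = refl

-- The label v is safe for {a,b} at the end a: if v is strong, every other edge {a,z}
-- labelled v has z adjacent to b, so no open path z – a – b in one strong class arises.
SafeAt : ∀ {n c} → Graph n → Labeling n c → Fin n → Fin n → Fin (suc c) → Set
SafeAt G L a b v = ∀ z → z ≢ b → Edge G a z → v ≢ zero → col L a z ≡ v → Edge G b z

relabel-STC : ∀ {n c} (G : Graph n) (L : Labeling n c) {a b v} → IsSTC G L →
  SafeAt G L a b v → SafeAt G L b a v → IsSTC G (relabel L a b v)
relabel-STC G L {a} {b} {v} stc safeA safeB u x y u≢y eux exy strong same
  with samePair? u x a b | samePair? x y a b
... | yes s₁ | yes s₂ = ⊥-elim (both s₁ s₂)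
  where
  both : SamePair u x a b → SamePair x y a b → ⊥
  both (inj₁ (refl , refl)) (inj₁ (refl , refl)) = Edge-irrefl G eux refl
  both (inj₁ (refl , refl)) (inj₂ (refl , refl)) = u≢y refl
  both (inj₂ (refl , refl)) (inj₁ (refl , refl)) = u≢y refl
  both (inj₂ (refl , refl)) (inj₂ (refl , refl)) = Edge-irrefl G eux refl
... | yes s₁ | no n₂ = first s₁
  where
  v-strong : v ≢ zero
  v-strong e = strong (trans (relabel-on L v s₁) e)
  xy-v : col L x y ≡ v
  xy-v = trans (sym (relabel-off L v n₂)) (trans (sym same) (relabel-on L v s₁))
  first : SamePair u x a b → Edge G u y
  first (inj₁ (refl , refl)) = safeB y (λ e → u≢y (sym e)) exy v-strong xy-v
  first (inj₂ (refl , refl)) = safeA y (λ e → u≢y (sym e)) exy v-strong xy-v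
... | no n₁ | yes s₂ = second s₂
  where
  ux-v : col L u x ≡ v
  ux-v = trans (sym (relabel-off L v n₁)) (trans same (relabel-on L v s₂))
  v-strong : v ≢ zero
  v-strong e = strong (trans (relabel-off L v n₁) (trans ux-v e))
  xu-v : col L x u ≡ v
  xu-v = trans (col-sym L x u) ux-v
  second : SamePair x y a b → Edge G u y
  second (inj₁ (refl , refl)) = Edge-sym G (safeA u u≢y (Edge-sym G eux) v-strong xu-v)
  second (inj₂ (refl , refl)) = Edge-sym G (safeB u u≢y (Edge-sym G eux) v-strong xu-v)
... | no n₁ | no n₂ = stc u x y u≢y eux exy
  (λ e → strong (trans (relabel-off L v n₁) e))
  (trans (sym (relabel-off L v n₁)) (trans same (relabel-off L v n₂)))

weaken-STC : ∀ {n c} (G : Graph n) (L : Labeling n c) a b → IsSTC G L → IsSTC G (relabel L a b zero)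
weaken-STC G L a b stc = relabel-STC G L stc (λ _ _ _ strong → ⊥-elim (strong refl))
                                              (λ _ _ _ strong → ⊥-elim (strong refl))

weakCell : ∀ {n c} → Graph n → Labeling n c → Fin n → Fin n → ℕ
weakCell G L u z = ind (⌊ toℕ u <? toℕ z ⌋ ∧ adj G u z ∧ isZero (col L u z))

weakCount≡∑∑ : ∀ {n c} (G : Graph n) (L : Labeling n c) →
  weakCount G L ≡ sum (λ u → sum (weakCell G L u))
weakCount≡∑∑ {n} G L = trans (listSum-tabulate n (λ u → u) _)
  (sum-cong-≗ (λ u → countB≡count (λ z → ⌊ toℕ u <? toℕ z ⌋ ∧ adj G u z ∧ isZero (col L u z))))

weakCell-ordered : ∀ {n c} (G : Graph n) (L : Labeling n c) {u z} → toℕ u < toℕ z → Edge G u z →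
  weakCell G L u z ≡ ind (isZero (col L u z))
weakCell-ordered G L {u} {z} u<z e with toℕ u <? toℕ z
... | yes _   rewrite e = refl
... | no u≮z = ⊥-elim (u≮z u<z)

weakCell-unordered : ∀ {n c} (G : Graph n) (L : Labeling n c) {u z} → ¬ toℕ u < toℕ z →
  weakCell G L u z ≡ 0
weakCell-unordered G L {u} {z} u≮z with toℕ u <? toℕ z
... | yes u<z = ⊥-elim (u≮z u<z)
... | no _    = refl

other-orientation : ∀ {n} {x y i j a b : Fin n} → SamePair x y a b → SamePair i j a b →
  ¬ (x ≡ i × y ≡ j) → x ≡ j × y ≡ i
other-orientation (inj₁ (refl , refl)) (inj₁ (refl , refl)) ne = ⊥-elim (ne (refl , refl))
other-orientation (inj₁ (refl , refl)) (inj₂ (refl , refl)) ne = refl , refl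
other-orientation (inj₂ (refl , refl)) (inj₁ (refl , refl)) ne = refl , refl
other-orientation (inj₂ (refl , refl)) (inj₂ (refl , refl)) ne = ⊥-elim (ne (refl , refl))

col-pair : ∀ {n c} (L : Labeling n c) {i j a b} → SamePair i j a b → col L i j ≡ col L a b
col-pair L (inj₁ (refl , refl)) = refl
col-pair L (inj₂ (refl , refl)) = col-sym L _ _

-- The weak count of a relabelling, computed in the cell (i,j) of the increasing orientation
-- of {a,b}: all other cells are unchanged.
weakCount-relabel-at : ∀ {n c} (G : Graph n) (L : Labeling n c) {a b} v i j →
  SamePair i j a b → toℕ i < toℕ j → Edge G i j →
  weakCount G (relabel L a b v) + ind (isZero (col L a b)) ≡ weakCount G L + ind (isZero v)
weakCount-relabel-at {n} {c} G L {a} {b} v i j s i<j eij = begin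
    weakCount G L' + ind (isZero (col L a b))             ≡⟨ cong₂ _+_ (weakCount≡∑∑ G L') (sym cell-before) ⟩
    sum (λ u → sum (weakCell G L' u)) + weakCell G L i j  ≡⟨ ∑∑-agree-off _ _ i j agree ⟩
    sum (λ u → sum (weakCell G L u)) + weakCell G L' i j  ≡⟨ cong₂ _+_ (sym (weakCount≡∑∑ G L)) cell-after ⟩
    weakCount G L + ind (isZero v)                        ∎
  where
  open ≡-Reasoning
  L' : Labeling n c
  L' = relabel L a b v
  cell-before : weakCell G L i j ≡ ind (isZero (col L a b))
  cell-before = trans (weakCell-ordered G L i<j eij) (cong (λ t → ind (isZero t)) (col-pair L s))
  cell-after : weakCell G L' i j ≡ ind (isZero v)
  cell-after = trans (weakCell-ordered G L' i<j eij) (cong (λ t → ind (isZero t)) (relabel-on L v s))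
  agree : ∀ x y → ¬ (x ≡ i × y ≡ j) → weakCell G L' x y ≡ weakCell G L x y
  agree x y ne with samePair? x y a b
  ... | no ns = cong (λ t → ind (⌊ toℕ x <? toℕ y ⌋ ∧ adj G x y ∧ isZero t)) (relabel-off L v ns)
  ... | yes s' with other-orientation s' s ne
  ...   | refl , refl = trans (weakCell-unordered G L' (<-asym i<j)) (sym (weakCell-unordered G L (<-asym i<j)))

weakCount-relabel : ∀ {n c} (G : Graph n) (L : Labeling n c) {a b} v → Edge G a b →
  weakCount G (relabel L a b v) + ind (isZero (col L a b)) ≡ weakCount G L + ind (isZero v)
weakCount-relabel G L {a} {b} v eab with <-cmp (toℕ a) (toℕ b)
... | tri< a<b _ _ = weakCount-relabel-at G L v a b (inj₁ (refl , refl)) a<b eab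
... | tri≈ _ a≡b _ = ⊥-elim (Edge-irrefl G eab (toℕ-injective a≡b))
... | tri> _ _ b<a = weakCount-relabel-at G L v b a (inj₂ (refl , refl)) b<a (Edge-sym G eab)

weakCount-strengthen : ∀ {n c} (G : Graph n) (L : Labeling n c) {a b} y → Edge G a b → col L a b ≡ zero →
  weakCount G (relabel L a b (suc y)) < weakCount G L
weakCount-strengthen {n} {c} G L {a} {b} y eab weak = ≤-reflexive (begin
    suc (weakCount G L')                         ≡⟨ +-comm 1 _ ⟩
    weakCount G L' + 1                           ≡⟨ cong (λ t → weakCount G L' + ind (isZero t)) weak ⟨
    weakCount G L' + ind (isZero (col L a b))    ≡⟨ weakCount-relabel G L (suc y) eab ⟩
    weakCount G L + 0                            ≡⟨ +-identityʳ _ ⟩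
    weakCount G L                                ∎)
  where
  open ≡-Reasoning
  L' : Labeling n c
  L' = relabel L a b (suc y)

weakCount-move : ∀ {n c} (G : Graph n) (L : Labeling n c) {a b x} → Edge G a b → Edge G b x → a ≢ x →
  col L a b ≡ zero → weakCount G (relabel (relabel L b x zero) a b (col L b x)) ≡ weakCount G L
weakCount-move {n} {c} G L {a} {b} {x} eab ebx a≢x weak = +-cancelʳ-≡ 1 _ _ (begin
    weakCount G M + 1                              ≡⟨ cong (λ t → weakCount G M + ind (isZero t)) ab-weak ⟨
    weakCount G M + ind (isZero (col L₁ a b))      ≡⟨ weakCount-relabel G L₁ (col L b x) eab ⟩
    weakCount G L₁ + ind (isZero (col L b x))      ≡⟨ weakCount-relabel G L zero ebx ⟩
    weakCount G L + 1                              ∎)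
  where
  open ≡-Reasoning
  L₁ M : Labeling n c
  L₁ = relabel L b x zero
  M  = relabel L₁ a b (col L b x)
  ab-weak : col L₁ a b ≡ zero
  ab-weak = trans (relabel-off L zero (not-pair (Edge-irrefl G eab) a≢x)) weak

degree : ∀ {n} → Graph n → Fin n → ℕ
degree G v = count (adj G v)

others : ∀ {n} → Graph n → Fin n → Fin n → Fin n → Bool
others G a b z = adj G a z ∧ not (does (z ≟ᶠ b))

uses : ∀ {n c} → Graph n → Labeling n c → Fin n → Fin n → Fin c → ℕ
uses G L a b = colourClass (others G a b) (col L a)

uses-witness : ∀ {n c} (G : Graph n) (L : Labeling n c) {a b z} y →
  Edge G a z → z ≢ b → col L a z ≡ suc y →
  (others G a b z ∧ does (col L a z ≟ᶠ suc y)) ≡ true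
uses-witness G L {a} {b} {z} y eaz z≢b colour
  rewrite eaz | dec-false (z ≟ᶠ b) z≢b | colour | dec-true (suc y ≟ᶠ suc y) refl = refl

uses-pos : ∀ {n c} (G : Graph n) (L : Labeling n c) {a b z} y → Edge G a z → z ≢ b → col L a z ≡ suc y →
  1 ≤ uses G L a b y
uses-pos G L {a} {b} {z} y eaz z≢b colour =
  count-pos (λ z → others G a b z ∧ does (col L a z ≟ᶠ suc y)) z (uses-witness G L y eaz z≢b colour)

unused-safe : ∀ {n c} (G : Graph n) (L : Labeling n c) {a b} y → uses G L a b y ≡ 0 → SafeAt G L a b (suc y)
unused-safe G L y none z z≢b eaz _ colour =
  ⊥-elim (1+n≰n (≤-trans (uses-pos G L y eaz z≢b colour) (≤-reflexive none)))

∑-uses : ∀ {n c} (G : Graph n) (L : Labeling n c) {a b} → degree G a ≤ ⌊ c /2⌋ + 1 → Edge G a b →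
  sum (uses G L a b) ≤ ⌊ c /2⌋
∑-uses {c = c} G L {a} {b} deg eab = ≤-trans (∑-colourClass (others G a b) (col L a))
  (+-cancelʳ-≤ 1 _ _ (≤-trans (≤-reflexive (count-remove (adj G a) b eab)) deg))

uses-two : ∀ {n c} (G : Graph n) (L : Labeling n c) {a b z z'} y →
  Edge G a z → z ≢ b → col L a z ≡ suc y →
  Edge G a z' → z' ≢ b → col L a z' ≡ suc y → z ≢ z' →
  2 ≤ uses G L a b y
uses-two G L {a} {b} {z} {z'} y eaz z≢b cz eaz' z'≢b cz' z≢z' =
  count-two (λ z → others G a b z ∧ does (col L a z ≟ᶠ suc y)) z z'
    (uses-witness G L y eaz z≢b cz) (uses-witness G L y eaz' z'≢b cz') z≢z'

around : ∀ {n c} → Graph n → Labeling n c → Fin n → Fin n → Fin c → ℕ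
around G L a b y = uses G L a b y + uses G L b a y

∑-around : ∀ {n c} (G : Graph n) (N : Labeling n c) {a b} →
  degree G a ≤ ⌊ c /2⌋ + 1 → degree G b ≤ ⌊ c /2⌋ + 1 → Edge G a b → sum (around G N a b) ≤ c
∑-around {c = c} G N {a} {b} degA degB eab = begin
    sum (around G N a b)                      ≡⟨ ∑-distrib-+ (uses G N a b) (uses G N b a) ⟩
    sum (uses G N a b) + sum (uses G N b a)   ≤⟨ +-mono-≤ (∑-uses G N degA eab)
                                                            (∑-uses G N degB (Edge-sym G eab)) ⟩
    ⌊ c /2⌋ + ⌊ c /2⌋                         ≤⟨ +-monoʳ-≤ ⌊ c /2⌋ (⌊n/2⌋≤⌈n/2⌉ c) ⟩
    ⌊ c /2⌋ + ⌈ c /2⌉                         ≡⟨ ⌊n/2⌋+⌈n/2⌉≡n c ⟩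
    c                                         ∎
  where open ≤-Reasoning

-- If every colour occurs at most once around {a,b}, then the label of a further edge {b,x}
-- can be moved onto {a,b}, making {b,x} weak: that colour occurs at b only on {b,x}, so it
-- occurs neither at a nor, once {b,x} is weak, elsewhere at b.
shift-STC : ∀ {n c} (G : Graph n) (N : Labeling n c) {a b x} → IsSTC G N →
  (∀ y → around G N a b y ≤ 1) → Edge G a b → Edge G b x → a ≢ x →
  IsSTC G (relabel (relabel N b x zero) a b (col N b x))
shift-STC G N {a} {b} {x} stc once eab ebx a≢x with col N b x in bx
... | zero  = weaken-STC G (relabel N b x zero) a b (weaken-STC G N b x stc)
... | suc y = relabel-STC G (relabel N b x zero) (weaken-STC G N b x stc) safeA safeB
  where
  x≢a : x ≢ a
  x≢a e = a≢x (sym e)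
  a≢b : a ≢ b
  a≢b = Edge-irrefl G eab
  safeA : SafeAt G (relabel N b x zero) a b (suc y)
  safeA z z≢b eaz _ cz =
    ⊥-elim (1+n≰n (≤-trans (+-mono-≤ (uses-pos G N y eaz z≢b cz') (uses-pos G N y ebx x≢a bx)) (once y)))
    where
    cz' : col N a z ≡ suc y
    cz' = trans (sym (relabel-off N zero (not-pair a≢b a≢x))) cz
  safeB : SafeAt G (relabel N b x zero) b a (suc y)
  safeB z z≢a ebz _ cz = ⊥-elim (two-at-b (z ≟ᶠ x))
    where
    two-at-b : Dec (z ≡ x) → ⊥
    two-at-b (yes refl) with () ← trans (sym (relabel-on N zero (inj₁ (refl , refl)))) cz
    two-at-b (no z≢x) =
      1+n≰n (≤-trans (≤-trans (uses-two G N y ebz z≢a cz' ebx x≢a bx z≢x) (m≤n+m _ _)) (once y))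
      where
      z≢b : z ≢ b
      z≢b e = Edge-irrefl G ebz (sym e)
      cz' : col N b z ≡ suc y
      cz' = trans (sym (relabel-off N zero (λ s → not-pair z≢b z≢x (samePair-flip s)))) cz

-- Let a – b – x be a path whose first two vertices have degree at most
-- ⌊c/2⌋ + 1.  Either some colour y occurs at neither end of {a,b}, and {a,b} may take it;
-- or, by pigeonhole, every colour occurs exactly once around {a,b}, and shift-STC applies.
strengthen-or-shift : ∀ {n c} (G : Graph n) (N : Labeling n c) {a b x} → IsSTC G N →
  degree G a ≤ ⌊ c /2⌋ + 1 → degree G b ≤ ⌊ c /2⌋ + 1 → Edge G a b → Edge G b x → a ≢ x →
  (Σ (Fin c) λ y → IsSTC G (relabel N a b (suc y)))
  ⊎ IsSTC G (relabel (relabel N b x zero) a b (col N b x))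
strengthen-or-shift G N {a} {b} stc degA degB eab ebx a≢x with any? (λ y → around G N a b y ≟ 0)
... | yes (y , none) = inj₁ (y , relabel-STC G N stc (unused-safe G N y (m+n≡0⇒m≡0 _ none))
                                                      (unused-safe G N y (m+n≡0⇒n≡0 (uses G N a b y) none)))
... | no no-free-colour = inj₂ (shift-STC G N stc once eab ebx a≢x)
  where
  once : ∀ y → around G N a b y ≤ 1
  once = at-most-one (around G N a b) (∑-around G N degA degB eab)
                     (λ y → n≢0⇒n>0 (λ e → no-free-colour (y , e)))

module _ {n c : ℕ} (G : Graph n) where

  AgreeOn : (Fin n → Fin n → Set) → Labeling n c → Labeling n c → Set
  AgreeOn F M L = ∀ u z → F u z → col M u z ≡ col L u z

  record Outcome (F : Fin n → Fin n → Set) (L : Labeling n c) (Goal : Labeling n c → Set) : Set where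
    constructor outcome
    field
      labeling : Labeling n c
      isSTC    : IsSTC G labeling
      agrees   : AgreeOn F labeling L
      progress : weakCount G labeling < weakCount G L
               ⊎ (weakCount G labeling ≡ weakCount G L × Goal labeling)

  outcome-weaken : ∀ {F F' L Goal} → (∀ u z → F' u z → F u z) → Outcome F L Goal → Outcome F' L Goal
  outcome-weaken F'⊆F (outcome M stc agree result) =
    outcome M stc (λ u z f → agree u z (F'⊆F u z f)) result

  outcome-map : ∀ {F L Goal Goal'} → (∀ M → AgreeOn F M L → Goal M → Goal' M) →
    Outcome F L Goal → Outcome F L Goal'
  outcome-map f (outcome M stc agree (inj₁ fewer))         = outcome M stc agree (inj₁ fewer)
  outcome-map f (outcome M stc agree (inj₂ (same , goal))) =
    outcome M stc agree (inj₂ (same , f M agree goal))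

  outcome-bind : ∀ {F F' L Goal Goal'} → Outcome F L Goal →
    (∀ M → IsSTC G M → AgreeOn F M L → Goal M → Outcome F' M Goal') →
    Outcome (λ u z → F u z × F' u z) L Goal'
  outcome-bind (outcome M stc agree (inj₁ fewer)) next =
    outcome M stc (λ u z f → agree u z (proj₁ f)) (inj₁ fewer)
  outcome-bind (outcome M stc agree (inj₂ (same , goal))) next with next M stc agree goal
  ... | outcome N stcN agreeN progress =
    outcome N stcN (λ u z f → trans (agreeN u z (proj₂ f)) (agree u z (proj₁ f)))
      (Data.Sum.map (λ fewer → <-≤-trans fewer (≤-reflexive same))
                    (Data.Product.map₁ (λ same' → trans same' same)) progress)

  shift-step : ∀ {N a b x} → IsSTC G N →
    degree G a ≤ ⌊ c /2⌋ + 1 → degree G b ≤ ⌊ c /2⌋ + 1 → Edge G a b → Edge G b x → a ≢ x →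
    col N a b ≡ zero →
    Outcome (λ u z → ¬ SamePair u z a b × ¬ SamePair u z b x) N
            (λ M → col M a b ≡ col N b x × col M b x ≡ zero)
  shift-step {N} {a} {b} {x} stc degA degB eab ebx a≢x weak
    with strengthen-or-shift G N stc degA degB eab ebx a≢x
  ... | inj₁ (y , stc') =
    outcome (relabel N a b (suc y)) stc' (λ u z f → relabel-off N (suc y) (proj₁ f))
            (inj₁ (weakCount-strengthen G N y eab weak))
  ... | inj₂ stc' =
    outcome M stc' agree (inj₂ (weakCount-move G N eab ebx a≢x weak , ab-moved , bx-weak))
    where
    N₁ M : Labeling n c
    N₁ = relabel N b x zero
    M  = relabel N₁ a b (col N b x)
    agree : AgreeOn (λ u z → ¬ SamePair u z a b × ¬ SamePair u z b x) M N
    agree u z (not-ab , not-bx) = trans (relabel-off N₁ _ not-ab) (relabel-off N zero not-bx)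
    x≢b : x ≢ b
    x≢b e = Edge-irrefl G ebx (sym e)
    ab-moved : col M a b ≡ col N b x
    ab-moved = relabel-on N₁ {a} {b} _ (inj₁ (refl , refl))
    bx-weak : col M b x ≡ zero
    bx-weak = trans (relabel-off N₁ {a} {b} {b} {x} _ (λ s → not-pair (λ e → a≢x (sym e)) x≢b (samePair-flip s)))
                    (relabel-on N {b} {x} zero (inj₁ (refl , refl)))

  module Walk (w : ℕ → Fin n)
    (walk-edge : ∀ t → Edge G (w t) (w (suc t)))
    (walk-degree : ∀ t → degree G (w t) ≤ ⌊ c /2⌋ + 1) where

    OnEdge : ℕ → Fin n → Fin n → Set
    OnEdge t u z = SamePair u z (w t) (w (suc t))

    OffWalk : ℕ → Fin n → Fin n → Set
    OffWalk m u z = ∀ t → t ≤ m → ¬ OnEdge t u z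

    Distinct : ℕ → Set
    Distinct m = ∀ t t' → t ≤ m → t' ≤ m → OnEdge t' (w t) (w (suc t)) → t ≡ t'

    ShiftedBack : ℕ → Labeling n c → Labeling n c → Set
    ShiftedBack m L M = (∀ t → t < m → col M (w t) (w (suc t)) ≡ col L (w (suc t)) (w (suc (suc t))))
                      × col M (w m) (w (suc m)) ≡ zero

    distinct-off : ∀ {m t t'} → Distinct m → t ≤ m → t' ≤ m → t' ≢ t → ¬ OnEdge t' (w t) (w (suc t))
    distinct-off distinct t≤m t'≤m t'≢t on = t'≢t (sym (distinct _ _ t≤m t'≤m on))

    distinct-pred : ∀ {m} → Distinct (suc m) → Distinct m
    distinct-pred distinct t t' t≤m t'≤m = distinct t t' (m≤n⇒m≤1+n t≤m) (m≤n⇒m≤1+n t'≤m)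

    no-return : ∀ {m} → Distinct (suc m) → w m ≢ w (suc (suc m))
    no-return {m} distinct e = distinct-off distinct ≤-refl (n≤1+n m) (λ ()) (inj₂ (refl , sym e))

    shift-along : ∀ m (L : Labeling n c) → Distinct m → IsSTC G L → col L (w 0) (w 1) ≡ zero →
      Outcome (OffWalk m) L (ShiftedBack m L)
    shift-along zero    L _        stc weak = outcome L stc (λ _ _ _ → refl) (inj₂ (refl , (λ _ ()) , weak))
    shift-along (suc m) L distinct stc weak =
      outcome-weaken split (outcome-bind (shift-along m L (distinct-pred distinct) stc weak) continue)
      where
      StepFixed : Fin n → Fin n → Set
      StepFixed u z = ¬ OnEdge m u z × ¬ OnEdge (suc m) u z

      split : ∀ u z → OffWalk (suc m) u z → OffWalk m u z × StepFixed u z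
      split u z off = (λ t t≤m → off t (m≤n⇒m≤1+n t≤m)) , off m (n≤1+n m) , off (suc m) ≤-refl

      earlier-fixed : ∀ {t} → t < m → StepFixed (w t) (w (suc t))
      earlier-fixed {t} t<m = distinct-off distinct t≤1+m (n≤1+n m) (λ e → <-irrefl (sym e) t<m)
                            , distinct-off distinct t≤1+m ≤-refl (λ e → <-irrefl (sym e) (m<n⇒m<1+n t<m))
        where
        t≤1+m : t ≤ suc m
        t≤1+m = m≤n⇒m≤1+n (<⇒≤ t<m)

      next-untouched : OffWalk m (w (suc m)) (w (suc (suc m)))
      next-untouched t t≤m = distinct-off distinct ≤-refl (m≤n⇒m≤1+n t≤m) (λ e → <-irrefl e (s≤s t≤m))

      continue : ∀ M → IsSTC G M → AgreeOn (OffWalk m) M L → ShiftedBack m L M →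
        Outcome StepFixed M (ShiftedBack (suc m) L)
      continue M stcM agreeM (earlier , last-weak) =
        outcome-map extend (shift-step stcM (walk-degree m) (walk-degree (suc m))
                              (walk-edge m) (walk-edge (suc m)) (no-return distinct) last-weak)
        where
        extend : ∀ N → AgreeOn StepFixed N M →
          col N (w m) (w (suc m)) ≡ col M (w (suc m)) (w (suc (suc m)))
            × col N (w (suc m)) (w (suc (suc m))) ≡ zero →
          ShiftedBack (suc m) L N
        extend N agreeN (moved , now-weak) = shifted , now-weak
          where
          shifted : ∀ t → t < suc m → col N (w t) (w (suc t)) ≡ col L (w (suc t)) (w (suc (suc t)))
          shifted t t<1+m with m<1+n⇒m<n∨m≡n t<1+m
          ... | inj₁ t<m  = trans (agreeN _ _ (earlier-fixed t<m)) (earlier t t<m)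
          ... | inj₂ refl = trans moved (agreeM _ _ next-untouched)

module _ {r : ℕ} .{{_ : NonZero r}} where

  shift : ℕ → Fin r → Fin r
  shift k j = (k + toℕ j) mod r

  toℕ-mod : ∀ m → toℕ (m mod r) ≡ m % r
  toℕ-mod m = toℕ-fromℕ< (m%n<n m r)

  %-absorbˡ : ∀ x y → (x % r + y) % r ≡ (x + y) % r
  %-absorbˡ x y = begin
    (x % r + y) % r         ≡⟨ %-distribˡ-+ (x % r) y r ⟩
    (x % r % r + y % r) % r ≡⟨ cong (λ t → (t + y % r) % r) (m%n%n≡m%n x r) ⟩
    (x % r + y % r) % r     ≡⟨ %-distribˡ-+ x y r ⟨
    (x + y) % r             ∎
    where open ≡-Reasoning

  %-absorbʳ : ∀ x y → (x + y % r) % r ≡ (x + y) % r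
  %-absorbʳ x y = begin
    (x + y % r) % r ≡⟨ cong (_% r) (+-comm x (y % r)) ⟩
    (y % r + x) % r ≡⟨ %-absorbˡ y x ⟩
    (y + x) % r     ≡⟨ cong (_% r) (+-comm y x) ⟩
    (x + y) % r     ∎
    where open ≡-Reasoning

  shift-zero : ∀ j → shift 0 j ≡ j
  shift-zero j = toℕ-injective (trans (toℕ-mod (toℕ j)) (m<n⇒m%n≡m (toℕ<n j)))

  nxt-shift : ∀ k j → nxt (shift k j) ≡ shift (suc k) j
  nxt-shift k j = toℕ-injective (begin
    toℕ (nxt (shift k j))        ≡⟨ toℕ-mod _ ⟩
    suc (toℕ (shift k j)) % r    ≡⟨ cong (λ t → suc t % r) (toℕ-mod _) ⟩
    (1 + (k + toℕ j) % r) % r    ≡⟨ %-absorbʳ 1 (k + toℕ j) ⟩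
    (suc k + toℕ j) % r          ≡⟨ toℕ-mod _ ⟨
    toℕ (shift (suc k) j)        ∎)
    where open ≡-Reasoning

  shift-nxt : ∀ k j → shift k (nxt j) ≡ shift (suc k) j
  shift-nxt k j = toℕ-injective (begin
    toℕ (shift k (nxt j))        ≡⟨ toℕ-mod _ ⟩
    (k + toℕ (nxt j)) % r        ≡⟨ cong (λ t → (k + t) % r) (toℕ-mod _) ⟩
    (k + suc (toℕ j) % r) % r    ≡⟨ %-absorbʳ k (suc (toℕ j)) ⟩
    (k + suc (toℕ j)) % r        ≡⟨ cong (_% r) (+-suc k (toℕ j)) ⟩
    (suc k + toℕ j) % r          ≡⟨ toℕ-mod _ ⟨
    toℕ (shift (suc k) j)        ∎)
    where open ≡-Reasoning

  shift-full : ∀ j → shift r j ≡ j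
  shift-full j = toℕ-injective (begin
    toℕ (shift r j)  ≡⟨ toℕ-mod _ ⟩
    (r + toℕ j) % r  ≡⟨ cong (_% r) (+-comm r (toℕ j)) ⟩
    (toℕ j + r) % r  ≡⟨ [m+n]%n≡m%n (toℕ j) r ⟩
    toℕ j % r        ≡⟨ m<n⇒m%n≡m (toℕ<n j) ⟩
    toℕ j            ∎)
    where open ≡-Reasoning

  offset : Fin r → Fin r → ℕ
  offset s j = (toℕ j + (r ∸ toℕ s)) % r

  offset<r : ∀ s j → offset s j < r
  offset<r s j = m%n<n _ r

  shift-offset : ∀ s j → shift (offset s j) s ≡ j
  shift-offset s j = toℕ-injective (begin
    toℕ (shift (offset s j) s)                 ≡⟨ toℕ-mod _ ⟩
    ((toℕ j + (r ∸ toℕ s)) % r + toℕ s) % r    ≡⟨ %-absorbˡ (toℕ j + (r ∸ toℕ s)) (toℕ s) ⟩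
    (toℕ j + (r ∸ toℕ s) + toℕ s) % r          ≡⟨ cong (_% r) (+-assoc (toℕ j) _ _) ⟩
    (toℕ j + ((r ∸ toℕ s) + toℕ s)) % r        ≡⟨ cong (λ t → (toℕ j + t) % r) (m∸n+n≡m (<⇒≤ (toℕ<n s))) ⟩
    (toℕ j + r) % r                            ≡⟨ [m+n]%n≡m%n (toℕ j) r ⟩
    toℕ j % r                                  ≡⟨ m<n⇒m%n≡m (toℕ<n j) ⟩
    toℕ j                                      ∎)
    where open ≡-Reasoning

  offset-shift : ∀ s {u} → u < r → offset s (shift u s) ≡ u
  offset-shift s {u} u<r = begin
    (toℕ (shift u s) + (r ∸ toℕ s)) % r        ≡⟨ cong (λ t → (t + (r ∸ toℕ s)) % r) (toℕ-mod _) ⟩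
    ((u + toℕ s) % r + (r ∸ toℕ s)) % r        ≡⟨ %-absorbˡ (u + toℕ s) (r ∸ toℕ s) ⟩
    (u + toℕ s + (r ∸ toℕ s)) % r              ≡⟨ cong (_% r) (+-assoc u _ _) ⟩
    (u + (toℕ s + (r ∸ toℕ s))) % r            ≡⟨ cong (λ t → (u + t) % r) (m+[n∸m]≡n (<⇒≤ (toℕ<n s))) ⟩
    (u + r) % r                                ≡⟨ [m+n]%n≡m%n u r ⟩
    u % r                                      ≡⟨ m<n⇒m%n≡m u<r ⟩
    u                                          ∎
    where open ≡-Reasoning

  shift-injective : ∀ s {u t} → u < r → t < r → shift u s ≡ shift t s → u ≡ t
  shift-injective s u<r t<r e =
    trans (sym (offset-shift s u<r)) (trans (cong (offset s) e) (offset-shift s t<r))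

-- Periphery vertices meet no edge of D, so their degree is at most ⌊c/2⌋ + 1.
periphery-degree : ∀ {n c} {G : Graph n} (D : DeletionSet G c) {v} → InPeriphery D v →
  degree G v ≤ ⌊ c /2⌋ + 1
periphery-degree {n} {c} {G} D {v} outside = begin
    count (adj G v)                              ≡⟨ count-cong no-D-edge ⟩
    count outsideD                               ≡⟨ countB≡count outsideD ⟨
    countB outsideD                              ≤⟨ degBound D v ⟩
    ⌊ c /2⌋ + 1                                  ∎
  where
  open ≤-Reasoning
  outsideD : Fin n → Bool
  outsideD z = adj G v z ∧ not (inD D v z)
  no-D-edge : ∀ z → adj G v z ≡ (adj G v z ∧ not (inD D v z))
  no-D-edge z with inD D v z in vz
  ... | true  = ⊥-elim (outside (z , vz))
  ... | false = sym (∧-identityʳ _)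

module Rotation {n c : ℕ} (G : Graph n) {r : ℕ} .{{_ : NonZero r}} (P : Fin r → Fin n)
  (cycle-edge : ∀ j → Edge G (P j) (P (nxt j)))
  (cycle-degree : ∀ j → degree G (P j) ≤ ⌊ c /2⌋ + 1)
  (cycle-distinct : ∀ i j → SamePair (P i) (P (nxt i)) (P j) (P (nxt j)) → i ≡ j) where

  OffCycle : Fin n → Fin n → Set
  OffCycle u z = ¬ InCycleEdges P u z

  RotatedBy : ℕ → Labeling n c → Labeling n c → Set
  RotatedBy k L M = (∀ j → colorSeq M P j ≡ colorSeq L P (shift k j)) × ∃ λ j → colorSeq M P j ≡ zero

  -- One rotation: walk once around the cycle starting at a weak edge s and shift all labels back.
  rotate-once : ∀ {L s} → IsSTC G L → colorSeq L P s ≡ zero → Outcome G OffCycle L (RotatedBy 1 L)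
  rotate-once {L} {s} stc weak =
    outcome-weaken G off-cycle⇒off-walk
      (outcome-map G rotated (shift-along (pred r) L distinct stc weak-start))
    where
    w : ℕ → Fin n
    w u = P (shift u s)
    w-next : ∀ u → P (nxt (shift u s)) ≡ w (suc u)
    w-next u = cong P (nxt-shift u s)
    open Walk G w (λ u → subst (Edge G (w u)) (w-next u) (cycle-edge (shift u s)))
                  (λ u → cycle-degree (shift u s))

    colorSeq-walk : ∀ M u → colorSeq M P (shift u s) ≡ col M (w u) (w (suc u))
    colorSeq-walk M u = cong (col M (w u)) (w-next u)

    ≤pred⇒< : ∀ {u} → u ≤ pred r → u < r
    ≤pred⇒< u≤ = subst (_ <_) (suc-pred r) (s≤s u≤)

    off-cycle⇒off-walk : ∀ u z → OffCycle u z → OffWalk (pred r) u z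
    off-cycle⇒off-walk u z off t _ on =
      off (shift t s , subst (SamePair u z (w t)) (sym (w-next t)) on)

    distinct : Distinct (pred r)
    distinct t t' t≤ t'≤ on = shift-injective s (≤pred⇒< t≤) (≤pred⇒< t'≤)
      (cycle-distinct _ _ (subst₂ (λ x y → SamePair (w t) x (w t') y)
                                  (sym (w-next t)) (sym (w-next t')) on))

    weak-start : col L (w 0) (w 1) ≡ zero
    weak-start = trans (sym (colorSeq-walk L 0)) (trans (cong (colorSeq L P) (shift-zero s)) weak)

    -- after r - 1 steps the walk is back at s, whose label was weak
    wrap : nxt (shift (pred r) s) ≡ s
    wrap = trans (nxt-shift (pred r) s) (trans (cong (λ k → shift k s) (suc-pred r)) (shift-full s))

    rotated : ∀ M → AgreeOn G (OffWalk (pred r)) M L → ShiftedBack (pred r) L M → RotatedBy 1 L M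
    rotated M _ (earlier , last-weak) = every-position , shift (pred r) s , trans (colorSeq-walk M (pred r)) last-weak
      where
      open ≡-Reasoning
      at : ∀ u → u ≤ pred r → colorSeq M P (shift u s) ≡ colorSeq L P (nxt (shift u s))
      at u u≤ with m≤n⇒m<n∨m≡n u≤
      ... | inj₁ u< = begin
        colorSeq M P (shift u s)                ≡⟨ colorSeq-walk M u ⟩
        col M (w u) (w (suc u))                 ≡⟨ earlier u u< ⟩
        col L (w (suc u)) (w (suc (suc u)))     ≡⟨ colorSeq-walk L (suc u) ⟨
        colorSeq L P (shift (suc u) s)          ≡⟨ cong (colorSeq L P) (nxt-shift u s) ⟨
        colorSeq L P (nxt (shift u s))          ∎
      ... | inj₂ refl = begin
        colorSeq M P (shift (pred r) s)         ≡⟨ colorSeq-walk M (pred r) ⟩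
        col M (w (pred r)) (w (suc (pred r)))   ≡⟨ last-weak ⟩
        zero                                    ≡⟨ weak ⟨
        colorSeq L P s                          ≡⟨ cong (colorSeq L P) wrap ⟨
        colorSeq L P (nxt (shift (pred r) s))   ∎

      -- every position j is reached after offset s j < r steps
      every-position : ∀ j → colorSeq M P j ≡ colorSeq L P (nxt j)
      every-position j = subst (λ i → colorSeq M P i ≡ colorSeq L P (nxt i)) (shift-offset s j)
                               (at (offset s j) (<⇒≤pred (offset<r s j)))

  -- k rotations in a row; each starts from the weak edge left by the previous one.
  rotate : ∀ k {L} → IsSTC G L → (∃ λ j → colorSeq L P j ≡ zero) → Outcome G OffCycle L (RotatedBy k L)
  rotate zero    {L} stc weak =
    outcome L stc (λ _ _ _ → refl) (inj₂ (refl , (λ j → cong (colorSeq L P) (sym (shift-zero j))) , weak))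
  rotate (suc k) {L} stc weak =
    outcome-weaken G (λ u z off → off , off) (outcome-bind G (rotate k stc weak) next)
    where
    next : ∀ M → IsSTC G M → AgreeOn G OffCycle M L → RotatedBy k L M →
      Outcome G OffCycle M (RotatedBy (suc k) L)
    next M stcM _ (rotM , s , weakM) = outcome-map G compose (rotate-once stcM weakM)
      where
      compose : ∀ N → AgreeOn G OffCycle N M → RotatedBy 1 M N → RotatedBy (suc k) L N
      compose N _ (rotN , weakN) =
        (λ j → trans (rotN j) (trans (rotM (nxt j)) (cong (colorSeq L P) (shift-nxt k j)))) , weakN

  fewer-or-rotated : ∀ {k L} (o : Outcome G OffCycle L (RotatedBy k L)) →
    weakCount G (Outcome.labeling o) < weakCount G L
    ⊎ (∀ j → colorSeq (Outcome.labeling o) P j ≡ colorSeq L P (shift k j))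
  fewer-or-rotated o = Data.Sum.map₂ (λ (_ , rotated , _) → rotated) (Outcome.progress o)

lemma26 : ∀ {n : ℕ} (G : Graph n) (c k : ℕ) (D : DeletionSet G c)
    (A : Fin n → Set) → IsPeripheryComponent D A →
    (L : Labeling n c) → IsSTC G L →
    (r : ℕ) .{{_ : NonZero r}} (P : Fin r → Fin n) → IsCycleIn G A r P →
    (∃ λ j → colorSeq L P j ≡ zero) →
    Σ (Fin r → Labeling n c) λ Ls →
      ∀ i → IsSTC G (Ls i)
          × PartiallyEqualOn G (λ u v → ¬ InCycleEdges P u v) (Ls i) L
          × (weakCount G (Ls i) < weakCount G L
             ⊎ (∀ j → colorSeq (Ls i) P j ≡ colorSeq L P ((toℕ i + toℕ j) mod r)))
lemma26 G _ _ D A (_ , inPeriphery , _) L stc r P (inA , edge , _ , distinct) weak =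
  (λ i → labeling (R i)) , λ i → isSTC (R i) , (λ u v _ off → agrees (R i) u v off) , fewer-or-rotated (R i)
  where
  open Rotation G P edge (λ j → periphery-degree D (inPeriphery (P j) (inA j))) distinct
  open Outcome
  R : ∀ i → Outcome G OffCycle L (RotatedBy (toℕ i) L)
  R i = rotate (toℕ i) stc weak
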